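{- For any online algorithm $\textsc{Alg}$ for any accept/reject accommodating problem, any upper bound on the competitive ratio of $\textsc{Alg}$ on accommodating sequences is also an upper bound on the online bounded ratio of $\textsc{Alg}$ (over all input sequences).
   Context: An accept/reject accommodating problem is an online maximization problem in which the algorithm can only accept or reject each request, the goal is to accept as many requests as possible (subject to feasibility), and the accommodating sequences are those input sequences for which an optimal offline algorithm $\textsc{Opt}$ accepts all requests. The competitive ratio of $\textsc{Alg}$ on accommodating sequences is the supremum of all $c$ for which there is a constant $\alpha$ with $\textsc{Alg}(I)\ge c\,\textsc{Opt}(I)-\alpha$ for all accommodating sequences $I$. $\textsc{Opt}_{\textsc{Alg}}$ denotes an offline algorithm that is optimal among offline algorithms whose solution on any input $I$ satisfies, for every prefix $I'$ of $I$, that it accepts at least $\textsc{Alg}(I')$ requests of $I'$; the online bounded ratio of $\textsc{Alg}$ is the supremum of all $c$ for which there is a constant $\alpha$ with $\textsc{Alg}(I)\ge c\,\textsc{Opt}_{\textsc{Alg}}(I)-\alpha$ for all input sequences $I$.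
   Formalization: The upper bound, the ratio values c and the additive constants α range over the rationals. -}

module Defs where

open import Data.Nat using (ℕ; zero; suc; _≤_)
open import Data.Bool using (Bool; true; false)
open import Data.List using (List; []; _∷_; _++_; [_]; length; take; replicate)
open import Data.Integer using (+_)
open import Data.Rational using (ℚ; _/_; _*_; _-_) renaming (_≤_ to _≤ℚ_)
open import Data.Product using (Σ; ∃; _×_; _,_)
open import Relation.Binary.PropositionalEquality using (_≡_)

-- An accept/reject problem: requests of type Req, and a feasibility predicate
-- on (input sequence, accept/reject decisions, one Bool per request, true = accept).
record AcceptRejectProblem : Set₁ where
  field
    Req      : Set
    Feasible : List Req → List Bool → Set

accepted : List Bool → ℕ
accepted []           = zero
accepted (true  ∷ ds) = suc (accepted ds)
accepted (false ∷ ds) = accepted ds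

⟦_⟧ : ℕ → ℚ
⟦ n ⟧ = + n / 1

module _ (P : AcceptRejectProblem) where
  open AcceptRejectProblem P

  -- A (deterministic) online algorithm decides on the current request knowing
  -- only the previously revealed requests (its earlier decisions are determined
  -- by these).
  OnlineAlg : Set
  OnlineAlg = List Req → Req → Bool

  runFrom : OnlineAlg → List Req → List Req → List Bool
  runFrom alg hist []       = []
  runFrom alg hist (r ∷ rs) = alg hist r ∷ runFrom alg (hist ++ [ r ]) rs

  run : OnlineAlg → List Req → List Bool
  run alg I = runFrom alg [] I

  ALG : OnlineAlg → List Req → ℕ
  ALG alg I = accepted (run alg I)

  IsAlgorithmFor : OnlineAlg → Set
  IsAlgorithmFor alg = ∀ I → Feasible I (run alg I)

  Solution : List Req → List Bool → Set
  Solution I d = (length d ≡ length I) × Feasible I d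

  IsOpt : List Req → ℕ → Set
  IsOpt I n = (Σ (List Bool) λ d → Solution I d × accepted d ≡ n)
            × (∀ d → Solution I d → accepted d ≤ n)

  Accommodating : List Req → Set
  Accommodating I = Solution I (replicate (length I) true)

  AlgBounded : OnlineAlg → List Req → List Bool → Set
  AlgBounded alg I d = ∀ k → k ≤ length I → ALG alg (take k I) ≤ accepted (take k d)

  IsOptAlg : OnlineAlg → List Req → ℕ → Set
  IsOptAlg alg I n = (Σ (List Bool) λ d → Solution I d × AlgBounded alg I d × accepted d ≡ n)
                   × (∀ d → Solution I d → AlgBounded alg I d → accepted d ≤ n)

  CompetitiveOnAccommodating : OnlineAlg → ℚ → Set
  CompetitiveOnAccommodating alg c =
    ∃ λ (α : ℚ) → ∀ I n → Accommodating I → IsOpt I n →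
      (c * ⟦ n ⟧) - α ≤ℚ ⟦ ALG alg I ⟧

  OnlineBounded : OnlineAlg → ℚ → Set
  OnlineBounded alg c =
    ∃ λ (α : ℚ) → ∀ I n → IsOptAlg alg I n →
      (c * ⟦ n ⟧) - α ≤ℚ ⟦ ALG alg I ⟧

module Submission where

-- On an accommodating sequence I, Opt accepts every request, so
-- Opt(I) = |I|.  The accept-everything solution is also admissible for
-- Opt_Alg: on a prefix of length k it accepts k requests, while Alg can
-- accept at most k of them.  Since Opt_Alg is a restriction of Opt, this
-- gives Opt_Alg(I) = Opt(I) on accommodating sequences.  Hence any c that
-- is a valid online bounded ratio (with additive constant α) is also a
-- valid competitive ratio on accommodating sequences (with the same α),
-- and every upper bound on the latter bounds the former.

open import Defs
open import Data.Rational using (ℚ; _≤_)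
open import Data.Nat as ℕ using (ℕ; zero; suc; z≤n; s≤s)
open import Data.Nat.Properties using (≤-trans; ≤-antisym; m≤n⇒m≤1+n; m⊓n≤m)
open import Data.Bool using (true; false)
open import Data.List using (List; []; _∷_; _++_; [_]; length; take; replicate)
open import Data.List.Properties using (length-take)
open import Data.Product using (_,_)
open import Relation.Binary.PropositionalEquality
  using (_≡_; refl; sym; trans; subst; cong)

accepted≤length : ∀ d → accepted d ℕ.≤ length d
accepted≤length []          = z≤n
accepted≤length (true  ∷ d) = s≤s (accepted≤length d)
accepted≤length (false ∷ d) = m≤n⇒m≤1+n (accepted≤length d)

accepted-allTrue : ∀ m → accepted (replicate m true) ≡ m
accepted-allTrue zero    = refl
accepted-allTrue (suc m) = cong suc (accepted-allTrue m)

accepted-take-allTrue : ∀ k m → k ℕ.≤ m → accepted (take k (replicate m true)) ≡ k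
accepted-take-allTrue zero    m       _       = refl
accepted-take-allTrue (suc k) (suc m) (s≤s p) = cong suc (accepted-take-allTrue k m p)

module _ (P : AcceptRejectProblem) where
  open AcceptRejectProblem P

  length-runFrom : ∀ (alg : OnlineAlg P) hist J → length (runFrom P alg hist J) ≡ length J
  length-runFrom alg hist []       = refl
  length-runFrom alg hist (r ∷ rs) = cong suc (length-runFrom alg (hist ++ [ r ]) rs)

  ALG-prefix≤ : ∀ (alg : OnlineAlg P) I k → ALG P alg (take k I) ℕ.≤ k
  ALG-prefix≤ alg I k =
    ≤-trans (accepted≤length (run P alg (take k I)))
            (subst (ℕ._≤ k) (sym length-decisions) (m⊓n≤m k (length I)))
    where
    length-decisions : length (run P alg (take k I)) ≡ k ℕ.⊓ length I
    length-decisions = trans (length-runFrom alg [] (take k I)) (length-take k I)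

  allTrue-AlgBounded : ∀ (alg : OnlineAlg P) I →
    AlgBounded P alg I (replicate (length I) true)
  allTrue-AlgBounded alg I k k≤|I| =
    subst (ALG P alg (take k I) ℕ.≤_)
          (sym (accepted-take-allTrue k (length I) k≤|I|))
          (ALG-prefix≤ alg I k)

  accommodating-Opt≡length : ∀ I n → Accommodating P I → IsOpt P I n → length I ≡ n
  accommodating-Opt≡length I n acc ((d , (|d|≡|I| , _) , acc-d≡n) , maximal) =
    ≤-antisym (subst (ℕ._≤ n) (accepted-allTrue (length I)) (maximal _ acc))
              (subst (n ℕ.≤_) |d|≡|I| (subst (ℕ._≤ length d) acc-d≡n (accepted≤length d)))

  -- Hence Opt and Opt_Alg coincide on accommodating sequences: the
  -- accept-everything solution attains Opt and is admissible for Opt_Alg,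
  -- and Opt_Alg optimises over a subset of the solutions Opt ranges over.
  accommodating-Opt⇒OptAlg : ∀ (alg : OnlineAlg P) I n →
    Accommodating P I → IsOpt P I n → IsOptAlg P alg I n
  accommodating-Opt⇒OptAlg alg I n acc opt@(_ , maximal) =
    ( ( replicate (length I) true , acc , allTrue-AlgBounded alg I
      , trans (accepted-allTrue (length I)) (accommodating-Opt≡length I n acc opt))
    , λ d sol _ → maximal d sol)

  onlineBounded⇒competitive : ∀ (alg : OnlineAlg P) c →
    OnlineBounded P alg c → CompetitiveOnAccommodating P alg c
  onlineBounded⇒competitive alg c (α , bound) =
    α , λ I n acc opt → bound I n (accommodating-Opt⇒OptAlg alg I n acc opt)

corollary1 : (P : AcceptRejectProblem) (alg : OnlineAlg P) → IsAlgorithmFor P alg →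
    (u : ℚ) → (∀ c → CompetitiveOnAccommodating P alg c → c ≤ u) →
    (∀ c → OnlineBounded P alg c → c ≤ u)
corollary1 P alg _ u competitive≤u c onlineBounded =
  competitive≤u c (onlineBounded⇒competitive P alg c onlineBounded)
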